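{- Let $n\ge2$ and let $\mathcal M$, $\mathcal N$, $\nu$ be as in the context. Then for every $a\in\mathcal M$ the sequence $\nu(a)$ is a one-column PBW-semistandard tableau, and the map $\tau:\mathcal M\to\mathcal N$, $a\mapsto b_{\nu(a)}$, is an isomorphism of posets.
   Context: $\mathcal M$ is the set of symbols $a_{i_1,\ldots,i_k}$, $1\le k\le n-1$, $1\le i_1<\dots<i_k\le n$, ordered by $a_{i_1,\ldots,i_k}\le a_{j_1,\ldots,j_l}$ iff $k\ge l$ and $i_r\le j_r$ for $1\le r\le l$. A one-column tableau $(\alpha_1,\ldots,\alpha_k)$ with entries in $[1,n]$ is PBW-semistandard if $\alpha_r\le k$ implies $\alpha_r=r$, and whenever $r_1<r_2$ with $\alpha_{r_1}>k$ and $\alpha_{r_2}>k$ we have $\alpha_{r_1}>\alpha_{r_2}$. A two-column tableau with columns $(\alpha_1,\ldots,\alpha_k)$ and $(\beta_1,\ldots,\beta_l)$ (in this order), $k\ge l$, is PBW-semistandard if both columns are and for every $r\in[1,l]$ there is $s\ge r$ with $\alpha_s\ge\beta_r$. $\mathcal N$ is the set of symbols $b_{\alpha_1,\ldots,\alpha_k}$, $1\le k\le n-1$, $(\alpha_1,\ldots,\alpha_k)$ a one-column PBW-semistandard tableau, ordered by $b_{\beta_1,\ldots,\beta_l}\le b_{\alpha_1,\ldots,\alpha_k}$ iff the two-column tableau with columns $(\alpha_1,\ldots,\alpha_k)$, $(\beta_1,\ldots,\beta_l)$ is PBW-semistandard. Let $P=\{(r,s):1\le r\le s\le n\}\setminus\{(1,1),(n,n)\}$;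 for $(r,s)\in P$ let $y_{r,s}=a_{\gamma_1,\ldots,\gamma_m}$ where $\{\gamma_1<\dots<\gamma_m\}=[1,n]\setminus[n-s+1,n+r-s]$. For $a\in\mathcal M$ let $J(a)=\{(r,s)\in P:y_{r,s}\le a\}$, let $\kappa$ be the largest $i$ with $(i,i)\in J(a)$ (and $\kappa=1$ if there is none), and let $(r_1,s_1),\ldots,(r_m,s_m)$ be the maximal elements of $J(a)$ (for the order $(r,s)\le(u,v)$ iff $r\le u$, $s\le v$) with $r_j<s_j$. Then $\nu(a)$ is the sequence obtained from $(1,2,\ldots,\kappa)$ by replacing each entry $r_j$ by $s_j$. -}

module Defs where

open import Data.Nat using (ℕ; zero; suc; _+_; _∸_; _≤_; _<_; _⊔_; _≤ᵇ_; _<ᵇ_; _≡ᵇ_)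
open import Data.Nat.Properties using (_≤?_)
open import Data.Bool using (Bool; true; false; _∧_; not; T)
open import Data.List using (List; []; _∷_; length; map; upTo; concatMap; filterᵇ; foldr)
open import Data.Product using (_×_; _,_; proj₁; proj₂; ∃)
open import Relation.Nullary using (Dec; yes; no; ¬_)
open import Relation.Binary.PropositionalEquality using (_≡_)
open import Relation.Nullary.Decidable using (⌊_⌋; _×-dec_)

-- xs ! r : the r-th entry (1-indexed); 0 when r is out of range
-- (only ever used for 1 ≤ r ≤ length xs).
_!_ : List ℕ → ℕ → ℕ
[] ! _ = 0
(x ∷ xs) ! zero = 0
(x ∷ xs) ! suc zero = x
(x ∷ xs) ! suc (suc r) = xs ! suc r

oneTo : ℕ → List ℕ
oneTo n = map suc (upTo n)

InRange : ℕ → List ℕ → Set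
InRange n xs = ∀ r → 1 ≤ r → r ≤ length xs → 1 ≤ xs ! r × xs ! r ≤ n

StrictlyIncreasing : List ℕ → Set
StrictlyIncreasing xs = ∀ r → 1 ≤ r → r < length xs → xs ! r < xs ! suc r

-- The poset M: a_{i_1,...,i_k} is represented by the list (i_1,...,i_k).

IsM : ℕ → List ℕ → Set
IsM n a = 1 ≤ length a × length a ≤ n ∸ 1 × InRange n a × StrictlyIncreasing a

_≤M_ : List ℕ → List ℕ → Set
a ≤M b = length b ≤ length a × (∀ r → 1 ≤ r → r ≤ length b → a ! r ≤ b ! r)

leqMᵇ : List ℕ → List ℕ → Bool
leqMᵇ _ [] = true
leqMᵇ [] (_ ∷ _) = false
leqMᵇ (i ∷ is) (j ∷ js) = (i ≤ᵇ j) ∧ leqMᵇ is js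

PBW1 : List ℕ → Set
PBW1 α =
  (∀ r → 1 ≤ r → r ≤ length α → α ! r ≤ length α → α ! r ≡ r)
  × (∀ r₁ r₂ → 1 ≤ r₁ → r₁ < r₂ → r₂ ≤ length α →
       length α < α ! r₁ → length α < α ! r₂ → α ! r₂ < α ! r₁)

PBW2 : List ℕ → List ℕ → Set
PBW2 α β =
  length β ≤ length α × PBW1 α × PBW1 β
  × (∀ r → 1 ≤ r → r ≤ length β →
       ∃ λ s → r ≤ s × s ≤ length α × β ! r ≤ α ! s)

IsN : ℕ → List ℕ → Set
IsN n α = 1 ≤ length α × length α ≤ n ∸ 1 × InRange n α × PBW1 α

_≤N_ : List ℕ → List ℕ → Set
β ≤N α = PBW2 α β

pairsP : ℕ → List (ℕ × ℕ)
pairsP n =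
  filterᵇ (λ p → not ((proj₁ p ≡ᵇ 1) ∧ (proj₂ p ≡ᵇ 1))
                 ∧ not ((proj₁ p ≡ᵇ n) ∧ (proj₂ p ≡ᵇ n)))
    (concatMap (λ s → map (λ r → (r , s)) (oneTo s)) (oneTo n))

y : ℕ → ℕ × ℕ → List ℕ
y n (r , s) =
  filterᵇ (λ i → not (((n ∸ s + 1) ≤ᵇ i) ∧ (i ≤ᵇ (n + r ∸ s)))) (oneTo n)

J : ℕ → List ℕ → List (ℕ × ℕ)
J n a = filterᵇ (λ p → leqMᵇ (y n p) a) (pairsP n)

leP : ℕ × ℕ → ℕ × ℕ → Bool
leP (r , s) (u , v) = (r ≤ᵇ u) ∧ (s ≤ᵇ v)

eqP : ℕ × ℕ → ℕ × ℕ → Bool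
eqP (r , s) (u , v) = (r ≡ᵇ u) ∧ (s ≡ᵇ v)

κ : ℕ → List ℕ → ℕ
κ n a = foldr _⊔_ 1 (map proj₁ (filterᵇ (λ p → proj₁ p ≡ᵇ proj₂ p) (J n a)))

allᵇ : {A : Set} → (A → Bool) → List A → Bool
allᵇ p [] = true
allᵇ p (x ∷ xs) = p x ∧ allᵇ p xs

maxOff : ℕ → List ℕ → List (ℕ × ℕ)
maxOff n a =
  filterᵇ (λ p → (proj₁ p <ᵇ proj₂ p)
                 ∧ allᵇ (λ q → not (leP p q ∧ not (eqP p q))) (J n a))
          (J n a)

replace : List (ℕ × ℕ) → ℕ → ℕ
replace [] i = i
replace ((r , s) ∷ ps) i with r ≡ᵇ i
... | true = s
... | false = replace ps i

ν : ℕ → List ℕ → List ℕ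
ν n a = map (replace (maxOff n a)) (oneTo (κ n a))

-- For a = a_{i_1,…,i_k} ∈ M put m = n − k. The excess i_t − t is nondecreasing in t with values
-- in [0, m]. Unfolding y_{r,s} ≤ a shows that (m, m) ∈ J(a), so κ = m, and that the maximal
-- off-diagonal elements of J(a) are exactly the pairs (p, n + 1 − j) where j is the first position
-- at which the excess reaches p and it equals p there. Hence ν(a)_p = n + 1 − j for such p, and
-- ν(a)_p = p when the excess never equals p. From this description the PBW conditions follow, and
-- comparing excesses shows that ν preserves and reflects the order; injectivity follows by
-- antisymmetry. A preimage of α ∈ N is i_t = t + D t, where D t is the last position of α holding an
-- entry ≥ n + 1 − t (or 0).

module Submission where

open import Defs
open import Data.Nat hiding (_!)
open import Data.Nat.Properties
open import Data.Bool using (Bool; true; false; _∧_; not; T)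
open import Data.Bool.Properties using (T?; T-∧)
open import Data.List using (List; []; _∷_; length; map; upTo; applyUpTo; concatMap; filterᵇ; foldr; _++_)
open import Data.List.Properties using (length-++; filter-++; filter-all; filter-none; length-map; length-upTo)
open import Data.List.Relation.Unary.All using (All; []; _∷_)
open import Data.List.Relation.Unary.Any using (here; there)
open import Data.List.Membership.Propositional using (_∈_; find; lose)
open import Data.List.Membership.Propositional.Properties
open import Data.Product using (_×_; _,_; proj₁; proj₂; ∃)
open import Data.Sum using (_⊎_; inj₁; inj₂)
open import Data.Empty using (⊥-elim)
open import Data.Unit using (tt)
open import Relation.Nullary using (yes; no; ¬_)
open import Relation.Unary using (Decidable)
open import Relation.Binary.PropositionalEquality hiding (J)
open import Function using (_∘_; case_of_)
open import Function.Bundles using (_⇔_; mk⇔; Equivalence)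

T-∧⁺ : ∀ {b c} → T b → T c → T (b ∧ c)
T-∧⁺ tb tc = Equivalence.from T-∧ (tb , tc)

T-∧ˡ : ∀ {b c} → T (b ∧ c) → T b
T-∧ˡ t = proj₁ (Equivalence.to T-∧ t)

T-∧ʳ : ∀ {b c} → T (b ∧ c) → T c
T-∧ʳ t = proj₂ (Equivalence.to T-∧ t)

T-not⁺ : ∀ {b} → ¬ T b → T (not b)
T-not⁺ {false} _ = tt
T-not⁺ {true} h = ⊥-elim (h tt)

T-not⁻ : ∀ {b} → T (not b) → ¬ T b
T-not⁻ {false} _ ()

≤ᵇ-false : ∀ {x y} → y < x → ¬ T (x ≤ᵇ y)
≤ᵇ-false {x} {y} y<x t = <⇒≱ y<x (≤ᵇ⇒≤ x y t)

∈-filterᵇ⁻ : ∀ {A : Set} (p : A → Bool) {x} xs → x ∈ filterᵇ p xs → x ∈ xs × T (p x)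
∈-filterᵇ⁻ p xs = ∈-filter⁻ (T? ∘ p)

∈-filterᵇ⁺ : ∀ {A : Set} (p : A → Bool) {x} xs → x ∈ xs → T (p x) → x ∈ filterᵇ p xs
∈-filterᵇ⁺ p xs = ∈-filter⁺ (T? ∘ p)

allᵇ⁻ : ∀ {A : Set} (p : A → Bool) xs → T (allᵇ p xs) → ∀ x → x ∈ xs → T (p x)
allᵇ⁻ p (y ∷ xs) h x (here refl) = T-∧ˡ h
allᵇ⁻ p (y ∷ xs) h x (there x∈) = allᵇ⁻ p xs (T-∧ʳ h) x x∈

allᵇ⁺ : ∀ {A : Set} (p : A → Bool) xs → (∀ x → x ∈ xs → T (p x)) → T (allᵇ p xs)
allᵇ⁺ p [] h = tt
allᵇ⁺ p (y ∷ xs) h = T-∧⁺ (h y (here refl)) (allᵇ⁺ p xs (λ x x∈ → h x (there x∈)))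

block : ℕ → ℕ → List ℕ
block a zero = []
block a (suc b) = suc a ∷ block (suc a) b

block-++ : ∀ a b c → block a (b + c) ≡ block a b ++ block (a + b) c
block-++ a zero c = cong (λ z → block z c) (sym (+-identityʳ a))
block-++ a (suc b) c = cong (suc a ∷_)
  (trans (block-++ (suc a) b c) (cong (λ z → block (suc a) b ++ block z c) (sym (+-suc a b))))

length-block : ∀ a b → length (block a b) ≡ b
length-block a zero = refl
length-block a (suc b) = cong suc (length-block (suc a) b)

block-! : ∀ a b p → 1 ≤ p → p ≤ b → block a b ! p ≡ p + a
block-! a (suc b) (suc zero) _ _ = refl
block-! a (suc b) (suc (suc p)) _ (s≤s p≤b) =
  trans (block-! (suc a) b (suc p) (s≤s z≤n) p≤b) (cong suc (+-suc p a))

All-block : ∀ {P : ℕ → Set} a b → (∀ x → a < x → x ≤ a + b → P x) → All P (block a b)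
All-block a zero h = []
All-block a (suc b) h =
  h (suc a) ≤-refl (subst (suc a ≤_) (sym (+-suc a b)) (s≤s (m≤m+n a b)))
  ∷ All-block (suc a) b (λ x a<x x≤ → h x (<-trans (n<1+n a) a<x) (subst (x ≤_) (sym (+-suc a b)) x≤))

oneTo≡block : ∀ K → oneTo K ≡ block 0 K
oneTo≡block K = go K 0 (λ i → i) (λ i → refl)
  where
  go : ∀ K a (f : ℕ → ℕ) → (∀ i → f i ≡ a + i) → map suc (applyUpTo f K) ≡ block a K
  go zero a f f≗ = refl
  go (suc K) a f f≗ = cong₂ _∷_ (cong suc (trans (f≗ 0) (+-identityʳ a)))
    (go K (suc a) (f ∘ suc) (λ i → trans (f≗ (suc i)) (+-suc a i)))

length-oneTo : ∀ K → length (oneTo K) ≡ K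
length-oneTo K = trans (length-map suc (upTo K)) (length-upTo K)

∈-oneTo⁻ : ∀ K {x} → x ∈ oneTo K → 1 ≤ x × x ≤ K
∈-oneTo⁻ K x∈ with ∈-map⁻ suc x∈
... | i , i∈ , refl = s≤s z≤n , ∈-upTo⁻ i∈

∈-oneTo⁺ : ∀ K {x} → 1 ≤ x → x ≤ K → x ∈ oneTo K
∈-oneTo⁺ K {suc i} _ i<K = ∈-map⁺ suc (∈-upTo⁺ i<K)

map-! : ∀ (f : ℕ → ℕ) xs p → 1 ≤ p → p ≤ length xs → map f xs ! p ≡ f (xs ! p)
map-! f (x ∷ xs) (suc zero) _ _ = refl
map-! f (x ∷ xs) (suc (suc p)) _ (s≤s p≤) = map-! f xs (suc p) (s≤s z≤n) p≤

map-oneTo-! : ∀ (f : ℕ → ℕ) K p → 1 ≤ p → p ≤ K → map f (oneTo K) ! p ≡ f p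
map-oneTo-! f K p 1≤p p≤K = begin
  map f (oneTo K) ! p ≡⟨ map-! f (oneTo K) p 1≤p (subst (p ≤_) (sym (length-oneTo K)) p≤K) ⟩
  f (oneTo K ! p)     ≡⟨ cong (λ xs → f (xs ! p)) (oneTo≡block K) ⟩
  f (block 0 K ! p)   ≡⟨ cong f (trans (block-! 0 K p 1≤p p≤K) (+-identityʳ p)) ⟩
  f p                 ∎
  where open ≡-Reasoning

length-map-oneTo : ∀ {A : Set} (f : ℕ → A) K → length (map f (oneTo K)) ≡ K
length-map-oneTo f K = trans (length-map f (oneTo K)) (length-oneTo K)

++-!ˡ : ∀ (xs ys : List ℕ) p → 1 ≤ p → p ≤ length xs → (xs ++ ys) ! p ≡ xs ! p
++-!ˡ (x ∷ xs) ys (suc zero) _ _ = refl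
++-!ˡ (x ∷ xs) ys (suc (suc p)) _ (s≤s p≤) = ++-!ˡ xs ys (suc p) (s≤s z≤n) p≤

++-!ʳ : ∀ (xs ys : List ℕ) p → 1 ≤ p → (xs ++ ys) ! (length xs + p) ≡ ys ! p
++-!ʳ [] ys p _ = refl
++-!ʳ (x ∷ []) ys (suc p) _ = refl
++-!ʳ (x ∷ x′ ∷ xs) ys p 1≤p = ++-!ʳ (x′ ∷ xs) ys p 1≤p

!-ext : ∀ (xs ys : List ℕ) → length xs ≡ length ys →
  (∀ r → 1 ≤ r → r ≤ length xs → xs ! r ≡ ys ! r) → xs ≡ ys
!-ext [] [] _ _ = refl
!-ext (x ∷ xs) (y ∷ ys) len≡ h = cong₂ _∷_ (h 1 ≤-refl (s≤s z≤n))
  (!-ext xs ys (suc-injective len≡) λ { (suc r) _ r≤ → h (suc (suc r)) (s≤s z≤n) (s≤s r≤) })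

leqMᵇ⇒≤M : ∀ a b → T (leqMᵇ a b) → a ≤M b
leqMᵇ⇒≤M a [] _ = z≤n , λ { (suc r) _ () }
leqMᵇ⇒≤M (i ∷ is) (j ∷ js) h with leqMᵇ⇒≤M is js (T-∧ʳ h)
... | len≤ , tail≤ = s≤s len≤ , λ
  { (suc zero) _ _ → ≤ᵇ⇒≤ i j (T-∧ˡ h)
  ; (suc (suc r)) _ (s≤s r≤) → tail≤ (suc r) (s≤s z≤n) r≤ }

≤M⇒leqMᵇ : ∀ a b → a ≤M b → T (leqMᵇ a b)
≤M⇒leqMᵇ a [] _ = tt
≤M⇒leqMᵇ (i ∷ is) (j ∷ js) (s≤s len≤ , entries≤) =
  T-∧⁺ (≤⇒≤ᵇ (entries≤ 1 ≤-refl (s≤s z≤n)))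
       (≤M⇒leqMᵇ is js (len≤ , λ { (suc r) _ r≤ → entries≤ (suc (suc r)) (s≤s z≤n) (s≤s r≤) }))

module YShape (n r s : ℕ) (r≤s : r ≤ s) (s≤n : s ≤ n) where
  A B : ℕ
  A = n ∸ s
  B = s ∸ r

  n≡A+r+B : n ≡ A + (r + B)
  n≡A+r+B = sym (begin
    n ∸ s + (r + (s ∸ r)) ≡⟨ cong (n ∸ s +_) (m+[n∸m]≡n r≤s) ⟩
    n ∸ s + s             ≡⟨ m∸n+n≡m s≤n ⟩
    n                     ∎)
    where open ≡-Reasoning

  A+B+r≡n : A + B + r ≡ n
  A+B+r≡n = trans (+-assoc A B r) (trans (cong (A +_) (+-comm B r)) (sym n≡A+r+B))

  y≡blocks : y n (r , s) ≡ block 0 A ++ block (A + r) B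
  y≡blocks = begin
    filterᵇ keep (oneTo n)                                   ≡⟨ cong (filterᵇ keep) (oneTo≡block n) ⟩
    filterᵇ keep (block 0 n)                                 ≡⟨ cong (λ z → filterᵇ keep (block 0 z)) n≡A+r+B ⟩
    filterᵇ keep (block 0 (A + (r + B)))                     ≡⟨ cong (filterᵇ keep) (block-++ 0 A (r + B)) ⟩
    filterᵇ keep (block 0 A ++ block A (r + B))              ≡⟨ cong (λ z → filterᵇ keep (block 0 A ++ z)) (block-++ A r B) ⟩
    filterᵇ keep (block 0 A ++ (block A r ++ block (A + r) B)) ≡⟨ filter-++ (T? ∘ keep) (block 0 A) _ ⟩
    filterᵇ keep (block 0 A) ++ filterᵇ keep (block A r ++ block (A + r) B)
      ≡⟨ cong (filterᵇ keep (block 0 A) ++_) (filter-++ (T? ∘ keep) (block A r) _) ⟩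
    filterᵇ keep (block 0 A) ++ (filterᵇ keep (block A r) ++ filterᵇ keep (block (A + r) B))
      ≡⟨ cong₂ (λ u v → u ++ (v ++ filterᵇ keep (block (A + r) B))) low-kept middle-dropped ⟩
    block 0 A ++ filterᵇ keep (block (A + r) B)             ≡⟨ cong (block 0 A ++_) high-kept ⟩
    block 0 A ++ block (A + r) B                             ∎
    where
    open ≡-Reasoning
    keep : ℕ → Bool
    keep i = not (((n ∸ s + 1) ≤ᵇ i) ∧ (i ≤ᵇ (n + r ∸ s)))
    n+r∸s≡A+r : n + r ∸ s ≡ A + r
    n+r∸s≡A+r = +-∸-comm r s≤n
    low-kept : filterᵇ keep (block 0 A) ≡ block 0 A
    low-kept = filter-all (T? ∘ keep) (All-block 0 A λ x _ x≤A →
      T-not⁺ (≤ᵇ-false (subst (x <_) (sym (+-comm A 1)) (s≤s x≤A)) ∘ T-∧ˡ))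
    middle-dropped : filterᵇ keep (block A r) ≡ []
    middle-dropped = filter-none (T? ∘ keep) (All-block A r λ x A<x x≤ kept →
      T-not⁻ kept (T-∧⁺ (≤⇒≤ᵇ (subst (_≤ x) (+-comm 1 A) A<x)) (≤⇒≤ᵇ (subst (x ≤_) (sym n+r∸s≡A+r) x≤))))
    high-kept : filterᵇ keep (block (A + r) B) ≡ block (A + r) B
    high-kept = filter-all (T? ∘ keep) (All-block (A + r) B λ x A+r<x _ →
      T-not⁺ (≤ᵇ-false (subst (_< x) (sym n+r∸s≡A+r) A+r<x) ∘ T-∧ʳ))

  length-y : length (y n (r , s)) ≡ A + B
  length-y = trans (cong length y≡blocks)
    (trans (length-++ (block 0 A)) (cong₂ _+_ (length-block 0 A) (length-block (A + r) B)))

  y-!-low : ∀ t → 1 ≤ t → t ≤ A → y n (r , s) ! t ≡ t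
  y-!-low t 1≤t t≤A = begin
    y n (r , s) ! t                       ≡⟨ cong (_! t) y≡blocks ⟩
    (block 0 A ++ block (A + r) B) ! t    ≡⟨ ++-!ˡ (block 0 A) _ t 1≤t (subst (t ≤_) (sym (length-block 0 A)) t≤A) ⟩
    block 0 A ! t                         ≡⟨ block-! 0 A t 1≤t t≤A ⟩
    t + 0                                 ≡⟨ +-identityʳ t ⟩
    t                                     ∎
    where open ≡-Reasoning

  y-!-high : ∀ t → A < t → t ≤ A + B → y n (r , s) ! t ≡ t + r
  y-!-high t A<t t≤A+B = begin
    y n (r , s) ! t                                            ≡⟨ cong₂ _!_ y≡blocks (sym A+u≡t) ⟩
    (block 0 A ++ block (A + r) B) ! (A + u)                   ≡⟨ cong (λ z → (block 0 A ++ block (A + r) B) ! (z + u)) (sym (length-block 0 A)) ⟩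
    (block 0 A ++ block (A + r) B) ! (length (block 0 A) + u)  ≡⟨ ++-!ʳ (block 0 A) _ u 1≤u ⟩
    block (A + r) B ! u                                        ≡⟨ block-! (A + r) B u 1≤u u≤B ⟩
    u + (A + r)                                                ≡⟨ sym (+-assoc u A r) ⟩
    u + A + r                                                  ≡⟨ cong (_+ r) (trans (+-comm u A) A+u≡t) ⟩
    t + r                                                      ∎
    where
    open ≡-Reasoning
    u = t ∸ A
    A+u≡t : A + u ≡ t
    A+u≡t = m+[n∸m]≡n (<⇒≤ A<t)
    1≤u : 1 ≤ u
    1≤u = m<n⇒0<n∸m A<t
    u≤B : u ≤ B
    u≤B = subst (u ≤_) (m+n∸m≡n A B) (∸-monoˡ-≤ A t≤A+B)

YBelow : ℕ → List ℕ → ℕ → ℕ → Set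
YBelow n a r s = length a + r ≤ n × (∀ t → 1 ≤ t → t ≤ length a → n ∸ s < t → t + r ≤ a ! t)

module _ {n r s : ℕ} (r≤s : r ≤ s) (s≤n : s ≤ n) (a : List ℕ) where
  open YShape n r s r≤s s≤n

  y≤M⇒YBelow : y n (r , s) ≤M a → YBelow n a r s
  y≤M⇒YBelow (k≤ , y≤a) = k+r≤n , λ t 1≤t t≤k A<t →
      subst (_≤ a ! t) (y-!-high t A<t (≤-trans t≤k k≤A+B)) (y≤a t 1≤t t≤k)
    where
    k≤A+B : length a ≤ A + B
    k≤A+B = subst (length a ≤_) length-y k≤
    k+r≤n : length a + r ≤ n
    k+r≤n = subst (length a + r ≤_) A+B+r≡n (+-monoˡ-≤ r k≤A+B)

  YBelow⇒y≤M : YBelow n a r s → (∀ t → 1 ≤ t → t ≤ length a → t ≤ a ! t) → y n (r , s) ≤M a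
  YBelow⇒y≤M (k+r≤n , high) t≤a = subst (length a ≤_) (sym length-y) k≤A+B , y≤a
    where
    k≤A+B : length a ≤ A + B
    k≤A+B = +-cancelʳ-≤ r (length a) (A + B) (subst (length a + r ≤_) (sym A+B+r≡n) k+r≤n)
    y≤a : ∀ t → 1 ≤ t → t ≤ length a → y n (r , s) ! t ≤ a ! t
    y≤a t 1≤t t≤k with t ≤? A
    ... | yes t≤A = subst (_≤ a ! t) (sym (y-!-low t 1≤t t≤A)) (t≤a t 1≤t t≤k)
    ... | no t≰A = subst (_≤ a ! t) (sym (y-!-high t A<t (≤-trans t≤k k≤A+B))) (high t 1≤t t≤k A<t)
      where
      A<t = ≰⇒> t≰A

InP : ℕ → ℕ → ℕ → Set
InP n r s = 1 ≤ r × r ≤ s × s ≤ n × ¬ (r ≡ 1 × s ≡ 1) × ¬ (r ≡ n × s ≡ n)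

triangle : ℕ → List (ℕ × ℕ)
triangle n = concatMap (λ s → map (λ r → (r , s)) (oneTo s)) (oneTo n)

∈-triangle⁻ : ∀ n {r s} → (r , s) ∈ triangle n → 1 ≤ r × r ≤ s × s ≤ n
∈-triangle⁻ n rs∈ with find (∈-concatMap⁻ (λ s → map (λ r → (r , s)) (oneTo s)) {xs = oneTo n} rs∈)
... | s , s∈ , rs∈′ with ∈-map⁻ (λ r → (r , s)) rs∈′
... | r , r∈ , refl = proj₁ (∈-oneTo⁻ s r∈) , proj₂ (∈-oneTo⁻ s r∈) , proj₂ (∈-oneTo⁻ n s∈)

∈-triangle⁺ : ∀ n {r s} → 1 ≤ r → r ≤ s → s ≤ n → (r , s) ∈ triangle n
∈-triangle⁺ n {r} {s} 1≤r r≤s s≤n = ∈-concatMap⁺ (λ s → map (λ r → (r , s)) (oneTo s)) {xs = oneTo n}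
  (lose (∈-oneTo⁺ n (≤-trans 1≤r r≤s) s≤n) (∈-map⁺ (λ r → (r , s)) (∈-oneTo⁺ s 1≤r r≤s)))

∈-pairsP⁻ : ∀ n {r s} → (r , s) ∈ pairsP n → InP n r s
∈-pairsP⁻ n {r} {s} rs∈ with ∈-filterᵇ⁻ _ (triangle n) rs∈
... | rs∈′ , kept with ∈-triangle⁻ n rs∈′
... | 1≤r , r≤s , s≤n = 1≤r , r≤s , s≤n ,
    (λ (r≡1 , s≡1) → T-not⁻ (T-∧ˡ kept) (T-∧⁺ (≡⇒≡ᵇ r 1 r≡1) (≡⇒≡ᵇ s 1 s≡1))) ,
    (λ (r≡n , s≡n) → T-not⁻ (T-∧ʳ kept) (T-∧⁺ (≡⇒≡ᵇ r n r≡n) (≡⇒≡ᵇ s n s≡n)))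

∈-pairsP⁺ : ∀ n {r s} → InP n r s → (r , s) ∈ pairsP n
∈-pairsP⁺ n {r} {s} (1≤r , r≤s , s≤n , ≢11 , ≢nn) = ∈-filterᵇ⁺ _ (triangle n) (∈-triangle⁺ n 1≤r r≤s s≤n)
  (T-∧⁺ (T-not⁺ λ t → ≢11 (≡ᵇ⇒≡ r 1 (T-∧ˡ t) , ≡ᵇ⇒≡ s 1 (T-∧ʳ t)))
        (T-not⁺ λ t → ≢nn (≡ᵇ⇒≡ r n (T-∧ˡ t) , ≡ᵇ⇒≡ s n (T-∧ʳ t))))

∈-J⁻ : ∀ n a {r s} → (r , s) ∈ J n a → InP n r s × YBelow n a r s
∈-J⁻ n a {r} {s} rs∈ with ∈-filterᵇ⁻ _ (pairsP n) rs∈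
... | rs∈P , y≤a with ∈-pairsP⁻ n rs∈P
... | inP@(_ , r≤s , s≤n , _) = inP , y≤M⇒YBelow r≤s s≤n a (leqMᵇ⇒≤M (y n (r , s)) a y≤a)

∈-J⁺ : ∀ n a {r s} → InP n r s → YBelow n a r s → (∀ t → 1 ≤ t → t ≤ length a → t ≤ a ! t) →
  (r , s) ∈ J n a
∈-J⁺ n a {r} {s} inP@(_ , r≤s , s≤n , _) below t≤a = ∈-filterᵇ⁺ _ (pairsP n) (∈-pairsP⁺ n inP)
  (≤M⇒leqMᵇ (y n (r , s)) a (YBelow⇒y≤M r≤s s≤n a below t≤a))

search-least : (Q : ℕ → Set) → Decidable Q → ∀ K →
  (∀ j → 1 ≤ j → j ≤ K → ¬ Q j) ⊎
  (∃ λ j → 1 ≤ j × j ≤ K × Q j × (∀ j′ → 1 ≤ j′ → j′ < j → ¬ Q j′))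
search-least Q Q? zero = inj₁ λ j 1≤j j≤0 _ → <⇒≱ 1≤j j≤0
search-least Q Q? (suc K) with search-least Q Q? K
... | inj₂ (j , 1≤j , j≤K , q , least) = inj₂ (j , 1≤j , m≤n⇒m≤1+n j≤K , q , least)
... | inj₁ none with Q? (suc K)
...   | yes q = inj₂ (suc K , s≤s z≤n , ≤-refl , q , λ j′ 1≤j′ j′<1+K → none j′ 1≤j′ (s≤s⁻¹ j′<1+K))
...   | no ¬q = inj₁ λ j 1≤j j≤1+K → case j ≟ suc K of λ where
          (yes refl) → ¬q
          (no j≢1+K) → none j 1≤j (s≤s⁻¹ (≤∧≢⇒< j≤1+K j≢1+K))

lastWhere : {Q : ℕ → Set} → Decidable Q → ℕ → ℕ
lastWhere Q? zero = 0
lastWhere Q? (suc K) with Q? (suc K)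
... | yes _ = suc K
... | no _ = lastWhere Q? K

module _ {Q : ℕ → Set} (Q? : Decidable Q) where

  lastWhere-≤ : ∀ K → lastWhere Q? K ≤ K
  lastWhere-≤ zero = z≤n
  lastWhere-≤ (suc K) with Q? (suc K)
  ... | yes _ = ≤-refl
  ... | no _ = m≤n⇒m≤1+n (lastWhere-≤ K)

  lastWhere-sound : ∀ K → lastWhere Q? K ≡ 0 ⊎ (1 ≤ lastWhere Q? K × Q (lastWhere Q? K))
  lastWhere-sound zero = inj₁ refl
  lastWhere-sound (suc K) with Q? (suc K)
  ... | yes q = inj₂ (s≤s z≤n , q)
  ... | no _ = lastWhere-sound K

  lastWhere-greatest : ∀ K p → 1 ≤ p → p ≤ K → Q p → p ≤ lastWhere Q? K
  lastWhere-greatest zero p 1≤p p≤0 _ = ⊥-elim (<⇒≱ 1≤p p≤0)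
  lastWhere-greatest (suc K) p 1≤p p≤1+K q with Q? (suc K)
  ... | yes _ = p≤1+K
  ... | no ¬q with p ≟ suc K
  ...   | yes refl = ⊥-elim (¬q q)
  ...   | no p≢1+K = lastWhere-greatest K p 1≤p (s≤s⁻¹ (≤∧≢⇒< p≤1+K p≢1+K)) q

lastWhere-mono : ∀ {Q R : ℕ → Set} (Q? : Decidable Q) (R? : Decidable R) →
  (∀ p → Q p → R p) → ∀ K → lastWhere Q? K ≤ lastWhere R? K
lastWhere-mono Q? R? Q⇒R K with lastWhere-sound Q? K
... | inj₁ ≡0 = subst (_≤ lastWhere R? K) (sym ≡0) z≤n
... | inj₂ (1≤L , q) = lastWhere-greatest R? K _ 1≤L (lastWhere-≤ Q? K) (Q⇒R _ q)

foldr-⊔-lub : ∀ xs M → 1 ≤ M → (∀ x → x ∈ xs → x ≤ M) → foldr _⊔_ 1 xs ≤ M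
foldr-⊔-lub [] M 1≤M _ = 1≤M
foldr-⊔-lub (x ∷ xs) M 1≤M ub = ⊔-lub (ub x (here refl)) (foldr-⊔-lub xs M 1≤M (λ y y∈ → ub y (there y∈)))

foldr-⊔-upper : ∀ xs x → x ∈ xs → x ≤ foldr _⊔_ 1 xs
foldr-⊔-upper (y ∷ xs) x (here refl) = m≤m⊔n x _
foldr-⊔-upper (y ∷ xs) x (there x∈) = ≤-trans (foldr-⊔-upper xs x x∈) (m≤n⊔m y _)

foldr-⊔-≥1 : ∀ xs → 1 ≤ foldr _⊔_ 1 xs
foldr-⊔-≥1 [] = ≤-refl
foldr-⊔-≥1 (y ∷ xs) = ≤-trans (foldr-⊔-≥1 xs) (m≤n⊔m y _)

replace-∈ : ∀ ps i s → (i , s) ∈ ps → (∀ s′ → (i , s′) ∈ ps → s′ ≡ s) → replace ps i ≡ s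
replace-∈ ((r , s₀) ∷ ps) i s is∈ unique with r ≡ᵇ i in r≟i
... | true = unique s₀ (here (cong (_, s₀) (sym (≡ᵇ⇒≡ r i (subst T (sym r≟i) tt)))))
... | false with is∈
...   | here e = ⊥-elim (subst T r≟i (≡⇒≡ᵇ r i (sym (cong proj₁ e))))
...   | there is∈′ = replace-∈ ps i s is∈′ (λ s′ is′∈ → unique s′ (there is′∈))

replace-∉ : ∀ ps i → (∀ s → ¬ (i , s) ∈ ps) → replace ps i ≡ i
replace-∉ [] i _ = refl
replace-∉ ((r , s₀) ∷ ps) i absent with r ≡ᵇ i in r≟i
... | true = ⊥-elim (absent s₀ (here (cong (_, s₀) (sym (≡ᵇ⇒≡ r i (subst T (sym r≟i) tt))))))
... | false = replace-∉ ps i (λ s is∈ → absent s (there is∈))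

Maximal : ℕ → List ℕ → ℕ → ℕ → Set
Maximal n a r s = ∀ u v → (u , v) ∈ J n a → r ≤ u → s ≤ v → r ≡ u × s ≡ v

notAbove : ℕ × ℕ → ℕ × ℕ → Bool
notAbove p q = not (leP p q ∧ not (eqP p q))

notAbove⁻ : ∀ r s u v → T (notAbove (r , s) (u , v)) → r ≤ u → s ≤ v → r ≡ u × s ≡ v
notAbove⁻ r s u v t r≤u s≤v with r ≟ u | s ≟ v
... | yes r≡u | yes s≡v = r≡u , s≡v
... | no r≢u | _ = ⊥-elim (T-not⁻ t (T-∧⁺ (T-∧⁺ (≤⇒≤ᵇ r≤u) (≤⇒≤ᵇ s≤v)) (T-not⁺ (r≢u ∘ ≡ᵇ⇒≡ r u ∘ T-∧ˡ))))
... | _ | no s≢v = ⊥-elim (T-not⁻ t (T-∧⁺ (T-∧⁺ (≤⇒≤ᵇ r≤u) (≤⇒≤ᵇ s≤v)) (T-not⁺ (s≢v ∘ ≡ᵇ⇒≡ s v ∘ T-∧ʳ))))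

notAbove⁺ : ∀ r s u v → (r ≤ u → s ≤ v → r ≡ u × s ≡ v) → T (notAbove (r , s) (u , v))
notAbove⁺ r s u v onlyEqual = T-not⁺ λ t → T-not⁻ (T-∧ʳ t) (coincide (T-∧ˡ t))
  where
  coincide : T ((r ≤ᵇ u) ∧ (s ≤ᵇ v)) → T ((r ≡ᵇ u) ∧ (s ≡ᵇ v))
  coincide t with onlyEqual (≤ᵇ⇒≤ r u (T-∧ˡ t)) (≤ᵇ⇒≤ s v (T-∧ʳ t))
  ... | r≡u , s≡v = T-∧⁺ (≡⇒≡ᵇ r u r≡u) (≡⇒≡ᵇ s v s≡v)

∈-maxOff⁻ : ∀ n a {r s} → (r , s) ∈ maxOff n a → (r , s) ∈ J n a × r < s × Maximal n a r s
∈-maxOff⁻ n a {r} {s} rs∈ with ∈-filterᵇ⁻ _ (J n a) rs∈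
... | rs∈J , t = rs∈J , <ᵇ⇒< r s (T-∧ˡ t) ,
    λ u v uv∈ → notAbove⁻ r s u v (allᵇ⁻ (notAbove (r , s)) (J n a) (T-∧ʳ t) (u , v) uv∈)

∈-maxOff⁺ : ∀ n a {r s} → (r , s) ∈ J n a → r < s → Maximal n a r s → (r , s) ∈ maxOff n a
∈-maxOff⁺ n a {r} {s} rs∈J r<s maximal = ∈-filterᵇ⁺ _ (J n a) rs∈J (T-∧⁺ (<⇒<ᵇ r<s)
  (allᵇ⁺ (notAbove (r , s)) (J n a) λ { (u , v) uv∈ → notAbove⁺ r s u v (maximal u v uv∈) }))

≤∸1⇒< : ∀ {k n} → 1 ≤ k → k ≤ n ∸ 1 → k < n
≤∸1⇒< {n = zero} 1≤k k≤0 = ⊥-elim (<⇒≱ 1≤k k≤0)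
≤∸1⇒< {n = suc n} _ k≤n = s≤s k≤n

module ColumnM (n : ℕ) (a : List ℕ) (a∈M : IsM n a) where
  k m : ℕ
  k = length a
  m = n ∸ k

  1≤k : 1 ≤ k
  1≤k = proj₁ a∈M

  k<n : k < n
  k<n = ≤∸1⇒< 1≤k (proj₁ (proj₂ a∈M))

  k+m≡n : k + m ≡ n
  k+m≡n = m+[n∸m]≡n (<⇒≤ k<n)

  n∸m≡k : n ∸ m ≡ k
  n∸m≡k = m∸[m∸n]≡n (<⇒≤ k<n)

  1≤m : 1 ≤ m
  1≤m = m<n⇒0<n∸m k<n

  m<n : m < n
  m<n = ∸-monoʳ-< 1≤k (<⇒≤ k<n)

  a!-range : ∀ t → 1 ≤ t → t ≤ k → 1 ≤ a ! t × a ! t ≤ n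
  a!-range = proj₁ (proj₂ (proj₂ a∈M))

  excess-mono : ∀ {t u p} → 1 ≤ t → t ≤ u → u ≤ k → t + p ≤ a ! t → u + p ≤ a ! u
  excess-mono {t} {zero} 1≤t t≤0 _ _ = ⊥-elim (<⇒≱ 1≤t t≤0)
  excess-mono {t} {suc u} 1≤t t≤1+u 1+u≤k t+p≤ with t ≟ suc u
  ... | yes refl = t+p≤
  ... | no t≢1+u = ≤-trans (s≤s (excess-mono 1≤t t≤u (≤-trans (n≤1+n u) 1+u≤k) t+p≤))
                           (proj₂ (proj₂ (proj₂ a∈M)) u (≤-trans 1≤t t≤u) 1+u≤k)
    where
    t≤u : t ≤ u
    t≤u = s≤s⁻¹ (≤∧≢⇒< t≤1+u t≢1+u)

  t≤a! : ∀ t → 1 ≤ t → t ≤ k → t ≤ a ! t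
  t≤a! t 1≤t t≤k = subst (_≤ a ! t) (+-identityʳ t)
    (excess-mono ≤-refl 1≤t t≤k (proj₁ (a!-range 1 ≤-refl 1≤k)))

  a!≤t+m : ∀ t → 1 ≤ t → t ≤ k → a ! t ≤ t + m
  a!≤t+m t 1≤t t≤k with a ! t ≤? t + m
  ... | yes a!≤ = a!≤
  ... | no a!≰ = ⊥-elim (<⇒≱ n<a!k (proj₂ (a!-range k 1≤k ≤-refl)))
    where
    n<a!k : n < a ! k
    n<a!k = subst (_< a ! k) k+m≡n (subst (_≤ a ! k) (+-suc k m)
      (excess-mono 1≤t t≤k ≤-refl (subst (_≤ a ! t) (sym (+-suc t m)) (≰⇒> a!≰))))

  m<1+n∸ : ∀ j → j ≤ k → m < suc n ∸ j
  m<1+n∸ j j≤k = subst (_≤ suc n ∸ j) (+-∸-assoc 1 (<⇒≤ k<n)) (∸-monoʳ-≤ (suc n) j≤k)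

  mm∈J : 2 ≤ m → (m , m) ∈ J n a
  mm∈J 2≤m = ∈-J⁺ n a
    (1≤m , ≤-refl , <⇒≤ m<n , (λ (m≡1 , _) → <⇒≢ 2≤m (sym m≡1)) , (λ (m≡n , _) → <⇒≢ m<n m≡n))
    (≤-reflexive k+m≡n , λ t _ t≤k n∸m<t → ⊥-elim (<⇒≱ n∸m<t (subst (t ≤_) (sym n∸m≡k) t≤k)))
    t≤a!

  ∈J⇒≤m : ∀ {r s} → (r , s) ∈ J n a → r ≤ m
  ∈J⇒≤m {r} rs∈ = m+n≤o⇒m≤o∸n r (subst (_≤ n) (+-comm k r) (proj₁ (proj₂ (∈-J⁻ n a rs∈))))

  record FirstHit (p j : ℕ) : Set where
    constructor firstHit
    field
      1≤j : 1 ≤ j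
      j≤k : j ≤ k
      at : a ! j ≡ j + p
      before : ∀ j′ → 1 ≤ j′ → j′ < j → a ! j′ < j′ + p

  NoHit : ℕ → Set
  NoHit p = ∀ j → 1 ≤ j → j ≤ k → a ! j ≢ j + p

  hit-or-none : ∀ p → NoHit p ⊎ ∃ (FirstHit p)
  hit-or-none p with search-least (λ j → j + p ≤ a ! j) (λ j → j + p ≤? a ! j) k
  ... | inj₁ none = inj₁ λ j 1≤j j≤k eq → none j 1≤j j≤k (≤-reflexive (sym eq))
  ... | inj₂ (j , 1≤j , j≤k , reached , least) with a ! j ≟ j + p
  ...   | yes at = inj₂ (j , firstHit 1≤j j≤k at λ j′ 1≤j′ j′<j → ≰⇒> (least j′ 1≤j′ j′<j))
  ...   | no a!j≢ = inj₁ λ j′ 1≤j′ j′≤k eq → case j′ <? j of λ where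
          (yes j′<j) → least j′ 1≤j′ j′<j (≤-reflexive (sym eq))
          (no j′≮j) → <-irrefl (sym eq) (subst (_≤ a ! j′) (+-suc j′ p)
                         (excess-mono 1≤j (≮⇒≥ j′≮j) j′≤k passed))
    where
    passed : j + suc p ≤ a ! j
    passed = subst (_≤ a ! j) (sym (+-suc j p)) (≤∧≢⇒< reached (a!j≢ ∘ sym))

  firstHit-≤ : ∀ {p j t} → FirstHit p j → 1 ≤ t → a ! t ≡ t + p → j ≤ t
  firstHit-≤ {t = t} (firstHit _ _ _ before) 1≤t at-t with t <? _
  ... | yes t<j = ⊥-elim (<-irrefl at-t (before t 1≤t t<j))
  ... | no t≮j = ≮⇒≥ t≮j

  firstHit-unique : ∀ {p j j′} → FirstHit p j → FirstHit p j′ → j ≡ j′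
  firstHit-unique h h′ =
    ≤-antisym (firstHit-≤ h (FirstHit.1≤j h′) (FirstHit.at h′)) (firstHit-≤ h′ (FirstHit.1≤j h) (FirstHit.at h))

  firstHit-< : ∀ {p q j j′} → FirstHit p j → FirstHit q j′ → p < q → j < j′
  firstHit-< {p} {q} {j} {j′} (firstHit _ j≤k at _) (firstHit 1≤j′ _ at′ _) p<q with j <? j′
  ... | yes j<j′ = j<j′
  ... | no j≮j′ = ⊥-elim (<⇒≱ p<q (+-cancelˡ-≤ j q p (subst (j + q ≤_) at
          (excess-mono 1≤j′ (≮⇒≥ j≮j′) j≤k (≤-reflexive (sym at′))))))

  firstHit⇒≤m : ∀ {p j} → FirstHit p j → p ≤ m
  firstHit⇒≤m {p} {j} (firstHit 1≤j j≤k at _) = +-cancelˡ-≤ j p m (subst (_≤ j + m) at (a!≤t+m j 1≤j j≤k))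

  hit-∈J : ∀ {p j} → 1 ≤ p → 1 ≤ j → j ≤ k → j + p ≤ a ! j → (p , suc n ∸ j) ∈ J n a
  hit-∈J {p} {suc j₀} 1≤p _ j≤k reached = ∈-J⁺ n a
    (1≤p , <⇒≤ (≤-<-trans p≤m m<s) , m∸n≤m n j₀ ,
     (λ (_ , s≡1) → <⇒≱ (subst (m <_) s≡1 m<s) 1≤m) , (λ (p≡n , _) → <⇒≢ (≤-<-trans p≤m m<n) p≡n))
    (subst (k + p ≤_) k+m≡n (+-monoʳ-≤ k p≤m) ,
     λ t _ t≤k n∸s<t → excess-mono (s≤s z≤n) (subst (_< t) n∸s≡j₀ n∸s<t) t≤k reached)
    t≤a!
    where
    p≤m : p ≤ m
    p≤m = +-cancelˡ-≤ (suc j₀) p m (≤-trans reached (a!≤t+m (suc j₀) (s≤s z≤n) j≤k))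
    m<s : m < n ∸ j₀
    m<s = m<1+n∸ (suc j₀) j≤k
    n∸s≡j₀ : n ∸ (n ∸ j₀) ≡ j₀
    n∸s≡j₀ = m∸[m∸n]≡n (≤-trans (n≤1+n j₀) (≤-trans j≤k (<⇒≤ k<n)))

  maxOff⇒firstHit : ∀ {p s} → (p , s) ∈ maxOff n a → ∃ λ j → FirstHit p j × s ≡ suc n ∸ j
  maxOff⇒firstHit {p} {s} ps∈ with ∈-maxOff⁻ n a ps∈
  ... | ps∈J , p<s , maximal with ∈-J⁻ n a ps∈J
  ... | (1≤p , _ , s≤n , _) , (_ , high) = j , firstHit (s≤s z≤n) j≤k at-j before-j , sym 1+n∸j≡s
    where
    j = suc (n ∸ s)
    1+n∸j≡s : suc n ∸ j ≡ s
    1+n∸j≡s = m∸[m∸n]≡n s≤n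
    p≤m = ∈J⇒≤m ps∈J
    m<s : m < s
    m<s with s ≤? m
    ... | no s≰m = ≰⇒> s≰m
    ... | yes s≤m with maximal m m (mm∈J (≤-trans (s≤s 1≤p) (≤-trans p<s s≤m))) p≤m s≤m
    ...   | p≡m , s≡m = ⊥-elim (<-irrefl (trans p≡m (sym s≡m)) p<s)
    j≤k : j ≤ k
    j≤k = subst (n ∸ s <_) n∸m≡k (∸-monoʳ-< m<s s≤n)
    at-j : a ! j ≡ j + p
    at-j with a ! j ≤? j + p
    ... | yes a!j≤ = ≤-antisym a!j≤ (high j (s≤s z≤n) j≤k ≤-refl)
    ... | no a!j≰ = ⊥-elim (<-irrefl (proj₁ (maximal (suc p) s above (n≤1+n p) ≤-refl)) (n<1+n p))
      where
      above : (suc p , s) ∈ J n a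
      above = subst (λ v → (suc p , v) ∈ J n a) 1+n∸j≡s
        (hit-∈J (s≤s z≤n) (s≤s z≤n) j≤k (subst (_≤ a ! j) (sym (+-suc j p)) (≰⇒> a!j≰)))
    before-j : ∀ j′ → 1 ≤ j′ → j′ < j → a ! j′ < j′ + p
    before-j j′ 1≤j′ j′<j with a ! j′ <? j′ + p
    ... | yes a!j′< = a!j′<
    ... | no a!j′≮ = ⊥-elim (<-irrefl (proj₂ (maximal p (suc n ∸ j′) above ≤-refl (<⇒≤ s<))) s<)
      where
      above : (p , suc n ∸ j′) ∈ J n a
      above = hit-∈J 1≤p 1≤j′ (≤-trans (<⇒≤ j′<j) j≤k) (≮⇒≥ a!j′≮)
      s< : s < suc n ∸ j′
      s< = subst (_< suc n ∸ j′) 1+n∸j≡s (∸-monoʳ-< j′<j (s≤s (m∸n≤m n s)))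

  firstHit⇒maxOff : ∀ {p j} → 1 ≤ p → FirstHit p j → (p , suc n ∸ j) ∈ maxOff n a
  firstHit⇒maxOff {p} {suc j₀} 1≤p fh@(firstHit _ j≤k at before) = ∈-maxOff⁺ n a ps∈J p<s maximal
    where
    ps∈J = hit-∈J 1≤p (s≤s z≤n) j≤k (≤-reflexive (sym at))
    p<s : p < n ∸ j₀
    p<s = ≤-<-trans (firstHit⇒≤m fh) (m<1+n∸ (suc j₀) j≤k)
    n∸s≡j₀ : n ∸ (n ∸ j₀) ≡ j₀
    n∸s≡j₀ = m∸[m∸n]≡n (≤-trans (n≤1+n j₀) (≤-trans j≤k (<⇒≤ k<n)))
    maximal : Maximal n a p (n ∸ j₀)
    maximal u v uv∈ p≤u s≤v with ∈-J⁻ n a uv∈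
    ... | (_ , _ , v≤n , _) , (_ , high) = p≡u , s≡v
      where
      n∸v<j : n ∸ v < suc j₀
      n∸v<j = s≤s (subst (n ∸ v ≤_) n∸s≡j₀ (∸-monoʳ-≤ n s≤v))
      p≡u : p ≡ u
      p≡u = ≤-antisym p≤u (+-cancelˡ-≤ (suc j₀) u p
              (subst (suc j₀ + u ≤_) at (high (suc j₀) (s≤s z≤n) j≤k n∸v<j)))
      s≡v : n ∸ j₀ ≡ v
      s≡v with n ∸ j₀ <? v
      ... | no s≮v = ≤-antisym s≤v (≮⇒≥ s≮v)
      ... | yes s<v = ⊥-elim (<⇒≱ (before j′ (s≤s z≤n) j′<j)
                                  (≤-trans (+-monoʳ-≤ j′ p≤u) (high j′ (s≤s z≤n) (≤-trans (<⇒≤ j′<j) j≤k) ≤-refl)))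
        where
        j′ = suc (n ∸ v)
        j′<j : j′ < suc j₀
        j′<j = s≤s (subst (n ∸ v <_) n∸s≡j₀ (∸-monoʳ-< s<v v≤n))

  κ≡m : κ n a ≡ m
  κ≡m = ≤-antisym (foldr-⊔-lub diagonal m 1≤m diagonal≤m) m≤κ
    where
    diagonal : List ℕ
    diagonal = map proj₁ (filterᵇ (λ p → proj₁ p ≡ᵇ proj₂ p) (J n a))
    diagonal≤m : ∀ x → x ∈ diagonal → x ≤ m
    diagonal≤m x x∈ with ∈-map⁻ proj₁ x∈
    ... | _ , rs∈ , refl = ∈J⇒≤m (proj₁ (∈-filterᵇ⁻ _ (J n a) rs∈))
    m≤κ : m ≤ κ n a
    m≤κ with m ≤? 1
    ... | yes m≤1 = ≤-trans m≤1 (foldr-⊔-≥1 diagonal)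
    ... | no m≰1 = foldr-⊔-upper diagonal m
          (∈-map⁺ proj₁ (∈-filterᵇ⁺ _ (J n a) (mm∈J (≰⇒> m≰1)) (≡⇒≡ᵇ m m refl)))

  length-ν : length (ν n a) ≡ m
  length-ν = trans (length-map-oneTo (replace (maxOff n a)) (κ n a)) κ≡m

  ν-! : ∀ p → 1 ≤ p → p ≤ m → ν n a ! p ≡ replace (maxOff n a) p
  ν-! p 1≤p p≤m = map-oneTo-! (replace (maxOff n a)) (κ n a) p 1≤p (subst (p ≤_) (sym κ≡m) p≤m)

  ν-!-noHit : ∀ {p} → 1 ≤ p → p ≤ m → NoHit p → ν n a ! p ≡ p
  ν-!-noHit {p} 1≤p p≤m none = trans (ν-! p 1≤p p≤m) (replace-∉ (maxOff n a) p λ s ps∈ →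
    let (j , firstHit 1≤j j≤k at _ , _) = maxOff⇒firstHit ps∈ in none j 1≤j j≤k at)

  ν-!-firstHit : ∀ {p j} → 1 ≤ p → FirstHit p j → ν n a ! p ≡ suc n ∸ j
  ν-!-firstHit {p} {j} 1≤p fh = trans (ν-! p 1≤p (firstHit⇒≤m fh))
    (replace-∈ (maxOff n a) p (suc n ∸ j) (firstHit⇒maxOff 1≤p fh) λ s ps∈ →
      let (j′ , fh′ , s≡) = maxOff⇒firstHit ps∈ in trans s≡ (cong (suc n ∸_) (firstHit-unique fh′ fh)))

  hit-below : ∀ {p t} → 1 ≤ t → t ≤ k → a ! t ≡ t + p → ∃ λ j → FirstHit p j × j ≤ t
  hit-below {p} {t} 1≤t t≤k at-t with hit-or-none p
  ... | inj₁ none = ⊥-elim (none t 1≤t t≤k at-t)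
  ... | inj₂ (j , fh) = j , fh , firstHit-≤ fh 1≤t at-t

  self≤ν! : ∀ p → 1 ≤ p → p ≤ m → p ≤ ν n a ! p
  self≤ν! p 1≤p p≤m with hit-or-none p
  ... | inj₁ none = ≤-reflexive (sym (ν-!-noHit 1≤p p≤m none))
  ... | inj₂ (j , fh) = subst (p ≤_) (sym (ν-!-firstHit 1≤p fh)) (≤-trans p≤m (<⇒≤ (m<1+n∸ j (FirstHit.j≤k fh))))

  ν!-range : ∀ p → 1 ≤ p → p ≤ m → 1 ≤ ν n a ! p × ν n a ! p ≤ n
  ν!-range p 1≤p p≤m with hit-or-none p
  ... | inj₁ none = subst (λ v → 1 ≤ v × v ≤ n) (sym (ν-!-noHit 1≤p p≤m none)) (1≤p , ≤-trans p≤m (<⇒≤ m<n))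
  ... | inj₂ (j , fh) = subst (λ v → 1 ≤ v × v ≤ n) (sym (ν-!-firstHit 1≤p fh))
        (≤-trans (s≤s z≤n) (m<1+n∸ j (FirstHit.j≤k fh)) , ∸-monoʳ-≤ (suc n) (FirstHit.1≤j fh))

  ν-PBW1 : PBW1 (ν n a)
  ν-PBW1 = small-fixed , large-decreasing
    where
    small-fixed : ∀ r → 1 ≤ r → r ≤ length (ν n a) → ν n a ! r ≤ length (ν n a) → ν n a ! r ≡ r
    small-fixed r 1≤r r≤ ν!≤ with hit-or-none r
    ... | inj₁ none = ν-!-noHit 1≤r (subst (r ≤_) length-ν r≤) none
    ... | inj₂ (j , fh) = ⊥-elim (<⇒≱ (m<1+n∸ j (FirstHit.j≤k fh))
          (subst₂ _≤_ (ν-!-firstHit 1≤r fh) length-ν ν!≤))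
    large-decreasing : ∀ r₁ r₂ → 1 ≤ r₁ → r₁ < r₂ → r₂ ≤ length (ν n a) →
      length (ν n a) < ν n a ! r₁ → length (ν n a) < ν n a ! r₂ → ν n a ! r₂ < ν n a ! r₁
    large-decreasing r₁ r₂ 1≤r₁ r₁<r₂ r₂≤ m<ν₁ m<ν₂ with hit-or-none r₁ | hit-or-none r₂
    ... | inj₁ none | _ = ⊥-elim (<⇒≱ m<ν₁ (subst₂ _≤_ (sym (ν-!-noHit 1≤r₁ r₁≤m none)) (sym length-ν) r₁≤m))
      where r₁≤m = ≤-trans (<⇒≤ r₁<r₂) (subst (r₂ ≤_) length-ν r₂≤)
    ... | _ | inj₁ none = ⊥-elim (<⇒≱ m<ν₂ (subst₂ _≤_ (sym (ν-!-noHit 1≤r₂ r₂≤m none)) (sym length-ν) r₂≤m))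
      where
      1≤r₂ = ≤-trans 1≤r₁ (<⇒≤ r₁<r₂)
      r₂≤m = subst (r₂ ≤_) length-ν r₂≤
    ... | inj₂ (j₁ , fh₁) | inj₂ (j₂ , fh₂) =
      subst₂ _<_ (sym (ν-!-firstHit (≤-trans 1≤r₁ (<⇒≤ r₁<r₂)) fh₂)) (sym (ν-!-firstHit 1≤r₁ fh₁))
        (∸-monoʳ-< (firstHit-< fh₁ fh₂ r₁<r₂) (≤-trans (FirstHit.j≤k fh₂) (≤-trans (<⇒≤ k<n) (n≤1+n n))))

  ν∈N : IsN n (ν n a)
  ν∈N = subst (1 ≤_) (sym length-ν) 1≤m ,
        subst (_≤ n ∸ 1) (sym length-ν) (∸-monoˡ-≤ 1 m<n) ,
        (λ r 1≤r r≤ → ν!-range r 1≤r (subst (r ≤_) length-ν r≤)) ,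
        ν-PBW1

module _ (n : ℕ) (a b : List ℕ) (a∈M : IsM n a) (b∈M : IsM n b) where
  private
    module A = ColumnM n a a∈M
    module B = ColumnM n b b∈M

  ν-mono : a ≤M b → ν n a ≤N ν n b
  ν-mono (kb≤ka , a≤b) =
    subst₂ _≤_ (sym A.length-ν) (sym B.length-ν) ma≤mb , B.ν-PBW1 , A.ν-PBW1 ,
    λ r 1≤r r≤ → covered r 1≤r (subst (r ≤_) A.length-ν r≤)
    where
    ma≤mb : A.m ≤ B.m
    ma≤mb = ∸-monoʳ-≤ n kb≤ka
    covered : ∀ r → 1 ≤ r → r ≤ A.m → ∃ λ s → r ≤ s × s ≤ length (ν n b) × ν n a ! r ≤ ν n b ! s
    covered r 1≤r r≤ma with A.hit-or-none r
    ... | inj₁ none = r , ≤-refl , subst (r ≤_) (sym B.length-ν) r≤mb ,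
          subst (_≤ ν n b ! r) (sym (A.ν-!-noHit 1≤r r≤ma none)) (B.self≤ν! r 1≤r r≤mb)
      where r≤mb = ≤-trans r≤ma ma≤mb
    ... | inj₂ (j , fh@(A.firstHit 1≤j _ at _)) with j ≤? B.k
    ...   | no j≰kb = B.m , ≤-trans r≤ma ma≤mb , ≤-reflexive (sym B.length-ν) ,
            subst (_≤ ν n b ! B.m) (sym (A.ν-!-firstHit 1≤r fh))
              (≤-trans (∸-monoʳ-≤ (suc n) (≰⇒> j≰kb)) (B.self≤ν! B.m B.1≤m ≤-refl))
    ...   | yes j≤kb with B.hit-below {b ! j ∸ j} 1≤j j≤kb (sym (m+[n∸m]≡n (B.t≤a! j 1≤j j≤kb)))
    ...     | j′ , fh′ , j′≤j = s , r≤s , subst (s ≤_) (sym B.length-ν) (B.firstHit⇒≤m fh′) ,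
              subst₂ _≤_ (sym (A.ν-!-firstHit 1≤r fh)) (sym (B.ν-!-firstHit (≤-trans 1≤r r≤s) fh′))
                (∸-monoʳ-≤ (suc n) j′≤j)
      where
      s = b ! j ∸ j
      r≤s : r ≤ s
      r≤s = +-cancelˡ-≤ j r s (subst₂ _≤_ at (sym (m+[n∸m]≡n (B.t≤a! j 1≤j j≤kb))) (a≤b j 1≤j j≤kb))

  ν-reflects : ν n a ≤N ν n b → a ≤M b
  ν-reflects (ma≤mb , _ , _ , covered) = kb≤ka , a≤b
    where
    kb≤ka : B.k ≤ A.k
    kb≤ka = subst₂ _≤_ B.n∸m≡k A.n∸m≡k (∸-monoʳ-≤ n (subst₂ _≤_ A.length-ν B.length-ν ma≤mb))
    -- if b_t < a_t, the excess r = a_t − t of a is first reached at some j ≤ t, so ν(a)_r = n + 1 − j;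
    -- the entry of ν(b) covering it forces the excess of b to reach r by position t
    not-overtaken : ∀ t → 1 ≤ t → t ≤ B.k → ¬ (b ! t < a ! t)
    not-overtaken t 1≤t t≤kb b<a =
      let j , fh , j≤t = A.hit-below 1≤t t≤ka a!t≡
          s , r≤s , s≤ , ν!r≤ν!s = covered r 1≤r (subst (r ≤_) (sym A.length-ν) (A.firstHit⇒≤m fh))
          1≤s = ≤-trans 1≤r r≤s
          s≤mb = subst (s ≤_) B.length-ν s≤
          1+n∸j≤ν!s = subst (_≤ ν n b ! s) (A.ν-!-firstHit 1≤r fh) ν!r≤ν!s
      in case B.hit-or-none s of λ where
        (inj₁ none) → <⇒≱ (B.m<1+n∸ j (≤-trans j≤t t≤kb))
                          (≤-trans 1+n∸j≤ν!s (subst (_≤ B.m) (sym (B.ν-!-noHit 1≤s s≤mb none)) s≤mb))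
        (inj₂ (j″ , fh″@(B.firstHit 1≤j″ j″≤kb at″ _))) →
          let j″≤j = ∸-cancelʳ-≤ (≤-trans j″≤kb (≤-trans (<⇒≤ B.k<n) (n≤1+n n)))
                                 (subst (suc n ∸ j ≤_) (B.ν-!-firstHit 1≤s fh″) 1+n∸j≤ν!s)
          in <⇒≱ b<a (subst (_≤ b ! t) (sym a!t≡) (≤-trans (+-monoʳ-≤ t r≤s)
               (B.excess-mono 1≤j″ (≤-trans j″≤j j≤t) t≤kb (≤-reflexive (sym at″)))))
      where
      t≤ka = ≤-trans t≤kb kb≤ka
      r = a ! t ∸ t
      a!t≡ : a ! t ≡ t + r
      a!t≡ = sym (m+[n∸m]≡n (A.t≤a! t 1≤t t≤ka))
      1≤r : 1 ≤ r
      1≤r = m<n⇒0<n∸m (≤-<-trans (B.t≤a! t 1≤t t≤kb) b<a)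
    a≤b : ∀ t → 1 ≤ t → t ≤ B.k → a ! t ≤ b ! t
    a≤b t 1≤t t≤kb = ≮⇒≥ (not-overtaken t 1≤t t≤kb)

PBW2-refl : ∀ α → PBW1 α → PBW2 α α
PBW2-refl α α-PBW1 = ≤-refl , α-PBW1 , α-PBW1 , λ r _ r≤ → r , ≤-refl , r≤ , ≤-refl

≤M-antisym : ∀ a b → a ≤M b → b ≤M a → a ≡ b
≤M-antisym a b (lb≤la , a≤b) (la≤lb , b≤a) =
  !-ext a b la≡lb λ r 1≤r r≤ → ≤-antisym (a≤b r 1≤r (subst (r ≤_) la≡lb r≤)) (b≤a r 1≤r r≤)
  where
  la≡lb = ≤-antisym la≤lb lb≤la

ν-injective : ∀ n a b → IsM n a → IsM n b → ν n a ≡ ν n b → a ≡ b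
ν-injective n a b a∈M b∈M ν≡ = ≤M-antisym a b
  (ν-reflects n a b a∈M b∈M (subst (_≤N ν n b) (sym ν≡) (PBW2-refl (ν n b) (ColumnM.ν-PBW1 n b b∈M))))
  (ν-reflects n b a b∈M a∈M (subst (_≤N ν n a) ν≡ (PBW2-refl (ν n a) (ColumnM.ν-PBW1 n a a∈M))))

module Preimage (n : ℕ) (α : List ℕ) (α∈N : IsN n α) where
  m k : ℕ
  m = length α
  k = n ∸ m

  1≤m : 1 ≤ m
  1≤m = proj₁ α∈N

  m<n : m < n
  m<n = ≤∸1⇒< 1≤m (proj₁ (proj₂ α∈N))

  k+m≡n : k + m ≡ n
  k+m≡n = m∸n+n≡m (<⇒≤ m<n)

  α-range : ∀ p → 1 ≤ p → p ≤ m → 1 ≤ α ! p × α ! p ≤ n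
  α-range = proj₁ (proj₂ (proj₂ α∈N))

  α-fixed : ∀ p → 1 ≤ p → p ≤ m → α ! p ≤ m → α ! p ≡ p
  α-fixed = proj₁ (proj₂ (proj₂ (proj₂ α∈N)))

  α-decreasing : ∀ p q → 1 ≤ p → p < q → q ≤ m → m < α ! p → m < α ! q → α ! q < α ! p
  α-decreasing = proj₂ (proj₂ (proj₂ (proj₂ α∈N)))

  D : ℕ → ℕ
  D t = lastWhere (λ p → suc n ∸ t ≤? α ! p) m

  D-≤ : ∀ t → D t ≤ m
  D-≤ t = lastWhere-≤ (λ p → suc n ∸ t ≤? α ! p) m

  D-sound : ∀ t → D t ≡ 0 ⊎ (1 ≤ D t × suc n ∸ t ≤ α ! D t)
  D-sound t = lastWhere-sound (λ p → suc n ∸ t ≤? α ! p) m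

  D-greatest : ∀ t p → 1 ≤ p → p ≤ m → suc n ∸ t ≤ α ! p → p ≤ D t
  D-greatest t = lastWhere-greatest (λ p → suc n ∸ t ≤? α ! p) m

  D-mono : ∀ t → D t ≤ D (suc t)
  D-mono t = lastWhere-mono _ _ (λ p → ≤-trans (∸-monoʳ-≤ (suc n) (n≤1+n t))) m

  a : List ℕ
  a = map (λ t → t + D t) (oneTo k)

  length-a : length a ≡ k
  length-a = length-map-oneTo _ k

  a-! : ∀ t → 1 ≤ t → t ≤ k → a ! t ≡ t + D t
  a-! = map-oneTo-! (λ t → t + D t) k

  a∈M : IsM n a
  a∈M = subst (1 ≤_) (sym length-a) (m<n⇒0<n∸m m<n) ,
        subst (_≤ n ∸ 1) (sym length-a) (∸-monoˡ-≤ 1 (∸-monoʳ-< 1≤m (<⇒≤ m<n))) ,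
        (λ t 1≤t t≤ → let t≤k = subst (t ≤_) length-a t≤ in
           subst (λ v → 1 ≤ v × v ≤ n) (sym (a-! t 1≤t t≤k))
             (≤-trans 1≤t (m≤m+n t (D t)) , subst (t + D t ≤_) k+m≡n (+-mono-≤ t≤k (D-≤ t)))) ,
        (λ t 1≤t t< → let t<k = subst (t <_) length-a t< in
           subst₂ _<_ (sym (a-! t 1≤t (<⇒≤ t<k))) (sym (a-! (suc t) (≤-trans 1≤t (n≤1+n t)) t<k))
             (s≤s (+-monoʳ-≤ t (D-mono t))))

  private
    module A = ColumnM n a a∈M

  mᵃ≡m : A.m ≡ m
  mᵃ≡m = trans (cong (n ∸_) length-a) (m∸[m∸n]≡n (<⇒≤ m<n))

  ν-small : ∀ p → 1 ≤ p → p ≤ m → α ! p ≤ m → ν n a ! p ≡ α ! p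
  ν-small p 1≤p p≤m α!p≤m =
    trans (A.ν-!-noHit 1≤p (subst (p ≤_) (sym mᵃ≡m) p≤m) noHit) (sym (α-fixed p 1≤p p≤m α!p≤m))
    where
    noHit : A.NoHit p
    noHit j 1≤j j≤kᵃ at = case D-sound j of λ where
        (inj₁ Dj≡0) → <⇒≱ 1≤p (≤-reflexive (trans (sym Dj≡p) Dj≡0))
        (inj₂ (_ , reached)) → <⇒≱ (subst (_< suc n ∸ j) mᵃ≡m (A.m<1+n∸ j j≤kᵃ))
                                   (≤-trans reached (subst (λ q → α ! q ≤ m) (sym Dj≡p) α!p≤m))
      where
      Dj≡p : D j ≡ p
      Dj≡p = +-cancelˡ-≡ j (D j) p (trans (sym (a-! j 1≤j (subst (j ≤_) length-a j≤kᵃ))) at)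

  ≥-large⇒≤ : ∀ p q → 1 ≤ p → q ≤ m → m < α ! p → α ! p ≤ α ! q → q ≤ p
  ≥-large⇒≤ p q 1≤p q≤m m<α!p α!p≤α!q = ≮⇒≥ λ p<q →
    <⇒≱ (α-decreasing p q 1≤p p<q q≤m m<α!p (<-≤-trans m<α!p α!p≤α!q)) α!p≤α!q

  ν-large : ∀ p → 1 ≤ p → p ≤ m → m < α ! p → ν n a ! p ≡ α ! p
  ν-large p 1≤p p≤m m<α!p = trans (A.ν-!-firstHit 1≤p hit) 1+n∸j≡α!p
    where
    α!p≤n = proj₂ (α-range p 1≤p p≤m)
    j = suc n ∸ α ! p
    1+n∸j≡α!p : suc n ∸ j ≡ α ! p
    1+n∸j≡α!p = m∸[m∸n]≡n (≤-trans α!p≤n (n≤1+n n))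
    1≤j : 1 ≤ j
    1≤j = m<n⇒0<n∸m (s≤s α!p≤n)
    j≤k : j ≤ k
    j≤k = ∸-monoʳ-≤ (suc n) m<α!p
    Dj≡p : D j ≡ p
    Dj≡p = ≤-antisym Dj≤p (D-greatest j p 1≤p p≤m (≤-reflexive 1+n∸j≡α!p))
      where
      Dj≤p : D j ≤ p
      Dj≤p with D-sound j
      ... | inj₁ ≡0 = subst (_≤ p) (sym ≡0) z≤n
      ... | inj₂ (_ , reached) = ≥-large⇒≤ p (D j) 1≤p (D-≤ j) m<α!p (subst (_≤ α ! D j) 1+n∸j≡α!p reached)
    before : ∀ j′ → 1 ≤ j′ → j′ < j → a ! j′ < j′ + p
    before j′ 1≤j′ j′<j = subst (_< j′ + p) (sym (a-! j′ 1≤j′ (≤-trans (<⇒≤ j′<j) j≤k))) (+-monoʳ-< j′ Dj′<p)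
      where
      Dj′<p : D j′ < p
      Dj′<p with D-sound j′
      ... | inj₁ ≡0 = subst (_< p) (sym ≡0) 1≤p
      ... | inj₂ (_ , reached) =
        ≤∧≢⇒< (≥-large⇒≤ p (D j′) 1≤p (D-≤ j′) m<α!p (<⇒≤ α!p<α!Dj′)) λ Dj′≡p → <-irrefl (cong (α !_) (sym Dj′≡p)) α!p<α!Dj′
        where
        α!p<α!Dj′ : α ! p < α ! D j′
        α!p<α!Dj′ = <-≤-trans (subst (_< suc n ∸ j′) 1+n∸j≡α!p (∸-monoʳ-< j′<j (m∸n≤m (suc n) (α ! p)))) reached
    hit : A.FirstHit p j
    hit = A.firstHit 1≤j (subst (j ≤_) (sym length-a) j≤k) (trans (a-! j 1≤j j≤k) (cong (j +_) Dj≡p)) before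

  ν-a≡α : ν n a ≡ α
  ν-a≡α = !-ext (ν n a) α (trans A.length-ν mᵃ≡m) λ p 1≤p p≤ →
    let p≤m = subst (p ≤_) (trans A.length-ν mᵃ≡m) p≤ in
    case α ! p ≤? m of λ where
      (yes α!p≤m) → ν-small p 1≤p p≤m α!p≤m
      (no α!p≰m) → ν-large p 1≤p p≤m (≰⇒> α!p≰m)

theorem6p5 : (n : ℕ) → 2 ≤ n →
    -- ν(a) is a one-column PBW-semistandard tableau (so b_{ν(a)} ∈ N)
    (∀ a → IsM n a → IsN n (ν n a))
    -- τ is injective on M
    × (∀ a b → IsM n a → IsM n b → ν n a ≡ ν n b → a ≡ b)
    -- τ is surjective onto N
    × (∀ α → IsN n α → ∃ λ a → IsM n a × ν n a ≡ α)
    -- τ preserves and reflects the order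
    × (∀ a b → IsM n a → IsM n b → (a ≤M b) ⇔ (ν n a ≤N ν n b))
theorem6p5 n _ =
  (λ a a∈M → ColumnM.ν∈N n a a∈M) ,
  ν-injective n ,
  (λ α α∈N → Preimage.a n α α∈N , Preimage.a∈M n α α∈N , Preimage.ν-a≡α n α α∈N) ,
  (λ a b a∈M b∈M → mk⇔ (ν-mono n a b a∈M b∈M) (ν-reflects n a b a∈M b∈M))
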